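{- Let $p$ be a positive even integer. Every oriented graph with at least $p+2$ vertices is $(=p)$-invertible.
   Context: For an oriented graph $D$ and $X\subseteq V(D)$, the inversion of $X$ reverses the orientation of every arc with both endpoints in $X$. A $(=p)$-inversion is the inversion of a set of exactly $p$ vertices. An oriented graph is $(=p)$-invertible if it can be made acyclic by a (finite, possibly empty) sequence of $(=p)$-inversions. -}

module Defs where

open import Data.Nat using (ℕ; zero; suc)
open import Data.Bool using (Bool; true; false; _∧_; not; if_then_else_)
open import Data.Fin using (Fin; zero; suc; inject₁; fromℕ)
open import Data.Fin.Subset using (Subset; ∣_∣)
open import Data.Vec using (lookup)
open import Data.List using (List; foldl)
open import Data.List.Relation.Unary.All using (All)
open import Data.Product using (Σ; _×_)
open import Relation.Binary.PropositionalEquality using (_≡_)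
open import Relation.Nullary using (¬_)
open import Function.Definitions using (Injective)

-- A digraph on vertex set Fin n: arc u v ≡ true iff there is an arc u → v.
Digraph : ℕ → Set
Digraph n = Fin n → Fin n → Bool

record IsOriented {n : ℕ} (D : Digraph n) : Set where
  field
    irrefl : ∀ v → D v v ≡ false
    asym   : ∀ u v → D u v ≡ true → D v u ≡ false

invert : ∀ {n} → Subset n → Digraph n → Digraph n
invert X D u v =
  if lookup X u ∧ lookup X v then D v u else D u v

invertAll : ∀ {n} → List (Subset n) → Digraph n → Digraph n
invertAll Xs D = foldl (λ E X → invert X E) D Xs

-- A directed cycle of length k+1: distinct vertices w 0, …, w k with
-- arcs w i → w (i+1) and w k → w 0.
record DirectedCycle {n : ℕ} (D : Digraph n) : Set where
  field
    k     : ℕ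
    w     : Fin (suc k) → Fin n
    inj   : Injective _≡_ _≡_ w
    step  : ∀ (i : Fin k) → D (w (inject₁ i)) (w (suc i)) ≡ true
    close : D (w (fromℕ k)) (w zero) ≡ true

Acyclic : ∀ {n} → Digraph n → Set
Acyclic D = ¬ DirectedCycle D

EqInvertible : ∀ {n} → ℕ → Digraph n → Set
EqInvertible {n} p D =
  Σ (List (Subset n)) λ Xs → All (λ X → ∣ X ∣ ≡ p) Xs × Acyclic (invertAll Xs D)

-- Work over ℤ/2. After inverting X₁, …, X_r, the pair {u, v} is reversed iff it lies inside an odd
-- number of the Xᵢ, so the patterns of pairs reversible by (=p)-inversions are closed under
-- symmetric difference. For distinct a, b, c pick a set Q of p − 1 vertices avoiding them and, for
-- each o ∈ Q, invert A ∪ {b} and A ∪ {c} where A = {a} ∪ Q ∖ {o}: the pairs inside A cancel, leaving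
-- the pairs between A and {b, c}; summing over o ∈ Q, and using that p − 1 is odd, only {a, b} and
-- {a, c} survive. Combining such triangles, {x, y} + {0, 1} is reversible for every pair {x, y}, so
-- every set of pairs can be reversed up to the pair {0, 1}. Reversing the arcs that point backwards
-- in the order of the vertices then leaves a graph ordered except possibly for 0 and 1, hence acyclic.
module Submission where

open import Algebra.Bundles using (CommutativeRing)
open import Data.Bool.Base using (Bool; true; false; not; _∧_; _∨_; _xor_; if_then_else_)
open import Data.Bool.Properties
  using (∧-comm; ∧-zeroʳ; ∨-zeroʳ; xor-assoc; xor-comm; xor-identityʳ; xor-same; xor-∧-commutativeRing)
open import Data.Fin.Base as Fin using (Fin; zero; suc; toℕ; inject₁; fromℕ)
open import Data.Fin.Properties using (_≟_; _<?_; <-asym; ≤∧≢⇒<; <⇒≢; toℕ-fromℕ; toℕ-inject₁)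
open import Data.Fin.Subset using (Subset; ∣_∣)
open import Data.List.Base using (List; []; _∷_; _++_)
open import Data.List.Relation.Unary.All using (All; []; _∷_)
open import Data.List.Relation.Unary.All.Properties using (++⁺)
open import Data.Maybe.Base using (Maybe; just; nothing)
open import Data.Nat.Base using (ℕ; zero; suc; _+_; _*_; _≤_; _<_; z≤n; s≤s)
open import Data.Nat.Divisibility using (_∣_; divides)
import Data.Nat.Properties as ℕ
open import Data.Product.Base using (Σ; _×_; _,_; proj₁; proj₂)
open import Data.Vec.Base using (tabulate; lookup)
import Data.Vec.Functional as Vector
open import Data.Vec.Properties using (lookup∘tabulate)
open import Function.Base using (_∘_)
open import Relation.Binary.PropositionalEquality
open import Relation.Nullary using (Dec; yes; no; does; contradiction)
open import Relation.Nullary.Decidable using (dec-true; dec-false)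
open import Tactic.RingSolver using (solve-∀)
open import Tactic.RingSolver.Core.AlmostCommutativeRing using (AlmostCommutativeRing; fromCommutativeRing)

open import Defs

open import Algebra.Properties.Semiring.Sum (CommutativeRing.semiring xor-∧-commutativeRing)
  using (sum; sum-syntax; sum-cong-≗; ∑-distrib-+; *-distribˡ-sum; *-distribʳ-sum; sum-replicate-zero)

private
  variable
    m n : ℕ

zero≟ : ∀ x → Maybe (false ≡ x)
zero≟ false = just refl
zero≟ true  = nothing

BoolRing : AlmostCommutativeRing _ _
BoolRing = fromCommutativeRing xor-∧-commutativeRing zero≟

_==_ : Fin n → Fin n → Bool
u == v = does (u ≟ v)

==-refl : (u : Fin n) → u == u ≡ true
==-refl u = dec-true (u ≟ u) refl

==-≢ : {u v : Fin n} → u ≢ v → u == v ≡ false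
==-≢ {u = u} {v} = dec-false (u ≟ v)

==⇒≡ : {u v : Fin n} → u == v ≡ true → u ≡ v
==⇒≡ {u = u} {v} with u ≟ v
... | yes u≡v = λ _ → u≡v
... | no _    = λ ()

==-separated : (Q : Fin n → Bool) {x o : Fin n} → Q x ≡ false → Q o ≡ true → x == o ≡ false
==-separated Q {x} {o} Qx≡false Qo≡true =
  ==-≢ {u = x} {o} λ { refl → contradiction (trans (sym Qx≡false) Qo≡true) λ () }

∑-select : (x : Fin n) (f : Fin n → Bool) → ∑[ z < n ] ((x == z) ∧ f z) ≡ f x
∑-select {suc n} zero    f = trans (cong (f zero xor_) (sum-replicate-zero n)) (xor-identityʳ (f zero))
∑-select {suc n} (suc x) f = ∑-select x (f ∘ suc)

⁅_⁆ : Fin n → Fin n → Bool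
⁅ x ⁆ z = z == x

_⊕_ : (Fin n → Bool) → (Fin n → Bool) → Fin n → Bool
(A ⊕ B) z = A z xor B z

size : (Fin n → Bool) → ℕ
size A = ∣ tabulate A ∣

size-cong : {A B : Fin n → Bool} → (∀ z → A z ≡ B z) → size A ≡ size B
size-cong {zero}  A≗B = refl
size-cong {suc n} {A} {B} A≗B with A zero | B zero | A≗B zero | size-cong (A≗B ∘ suc)
... | true  | .true  | refl | eq = cong suc eq
... | false | .false | refl | eq = eq

size-∅ : size {n} (λ _ → false) ≡ 0
size-∅ {zero}  = refl
size-∅ {suc n} = size-∅ {n}

size-⁅⁆ : (x : Fin n) → size ⁅ x ⁆ ≡ 1
size-⁅⁆ {suc n} zero    = cong suc (size-∅ {n})
size-⁅⁆ {suc n} (suc x) = size-⁅⁆ x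

size-insert : (x : Fin n) (A : Fin n → Bool) → A x ≡ false → size (⁅ x ⁆ ⊕ A) ≡ suc (size A)
size-insert zero    A Ax≡false with A zero
... | false = refl
size-insert (suc x) A Ax≡false with A zero | size-insert x (A ∘ suc) Ax≡false
... | true  | eq = cong suc eq
... | false | eq = eq

size-∨ : (A B : Fin n → Bool) → size (λ z → A z ∨ B z) ≤ size A + size B
size-∨ {zero}  A B = z≤n
size-∨ {suc n} A B with A zero | B zero | size-∨ (A ∘ suc) (B ∘ suc)
... | true  | true  | le = s≤s (ℕ.≤-trans le (ℕ.≤-trans (ℕ.n≤1+n _) (ℕ.≤-reflexive (sym (ℕ.+-suc _ _)))))
... | true  | false | le = s≤s le
... | false | true  | le = ℕ.≤-trans (s≤s le) (ℕ.≤-reflexive (sym (ℕ.+-suc _ _)))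
... | false | false | le = le

subset-avoiding : (k : ℕ) (T : Fin n → Bool) → k + size T ≤ n →
  Σ (Fin n → Bool) λ Q → size Q ≡ k × (∀ z → T z ≡ true → Q z ≡ false)
subset-avoiding {n}     zero    T _    = (λ _ → false) , size-∅ {n} , λ _ _ → refl
subset-avoiding {suc n} (suc k) T room with T zero in T0
... | true  with subset-avoiding (suc k) (T ∘ suc) room′
  where
  room′ : suc k + size (T ∘ suc) ≤ n
  room′ = ℕ.≤-pred (ℕ.≤-trans (ℕ.≤-reflexive (sym (ℕ.+-suc (suc k) _))) room)
...   | Q , size-Q , avoids = false Vector.∷ Q , size-Q , λ { zero _ → refl ; (suc z) → avoids z }
subset-avoiding {suc n} (suc k) T room | false with subset-avoiding k (T ∘ suc) (ℕ.≤-pred room)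
...   | Q , size-Q , avoids = true Vector.∷ Q , cong suc size-Q , λ
  { zero    T0≡true → contradiction (trans (sym T0) T0≡true) λ ()
  ; (suc z)         → avoids z
  }

∑-even : (A : Fin n → Bool) (q : ℕ) → size A ≡ q * 2 → ∑[ z < n ] A z ≡ false
∑-odd  : (A : Fin n → Bool) (q : ℕ) → size A ≡ suc (q * 2) → ∑[ z < n ] A z ≡ true

∑-even {zero}  A q       _ = refl
∑-even {suc n} A q       even with A zero
∑-even {suc n} A (suc q) even | true  = cong not (∑-odd (A ∘ suc) q (ℕ.suc-injective even))
∑-even {suc n} A q       even | false = ∑-even (A ∘ suc) q even

∑-odd {suc n} A q odd with A zero
... | true  = cong not (∑-even (A ∘ suc) q (ℕ.suc-injective odd))
... | false = ∑-odd (A ∘ suc) q odd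

Pattern : ℕ → Set
Pattern n = Fin n → Fin n → Bool

inside : (Fin n → Bool) → Pattern n
inside A u v = A u ∧ A v

cross : (Fin n → Bool) → (Fin n → Bool) → Pattern n
cross A B u v = (A u ∧ B v) xor (B u ∧ A v)

pair : Fin n → Fin n → Pattern n
pair x y = cross ⁅ x ⁆ ⁅ y ⁆

pair-comm : (x y u v : Fin n) → pair x y u v ≡ pair y x u v
pair-comm x y u v = xor-comm ((u == x) ∧ (v == y)) ((u == y) ∧ (v == x))

inside-⁅⁆ : (x : Fin n) {u v : Fin n} → u ≢ v → inside ⁅ x ⁆ u v ≡ false
inside-⁅⁆ x {u} {v} u≢v with u == x in u≡x
... | false = refl
... | true  = ==-≢ λ v≡x → u≢v (trans (==⇒≡ u≡x) (sym v≡x))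

inside-twins : (A B C : Fin n → Bool) (u v : Fin n) →
  inside (B ⊕ A) u v xor inside (C ⊕ A) u v ≡ (inside B u v xor inside C u v) xor cross A (B ⊕ C) u v
inside-twins A B C u v = identity (A u) (A v) (B u) (B v) (C u) (C v)
  where
  identity : ∀ a a′ b b′ c c′ →
    ((b xor a) ∧ (b′ xor a′)) xor ((c xor a) ∧ (c′ xor a′)) ≡
    ((b ∧ b′) xor (c ∧ c′)) xor ((a ∧ (b′ xor c′)) xor ((b xor c) ∧ a′))
  identity = solve-∀ BoolRing

cross-⊕ʳ : (A B C : Fin n → Bool) (u v : Fin n) → cross A (B ⊕ C) u v ≡ cross A B u v xor cross A C u v
cross-⊕ʳ A B C u v = identity (A u) (A v) (B u) (B v) (C u) (C v)
  where
  identity : ∀ a a′ b b′ c c′ →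
    (a ∧ (b′ xor c′)) xor ((b xor c) ∧ a′) ≡ ((a ∧ b′) xor (b ∧ a′)) xor ((a ∧ c′) xor (c ∧ a′))
  identity = solve-∀ BoolRing

∑-cross : (w : Fin m → Bool) (A : Fin m → Fin n → Bool) (B : Fin n → Bool) (u v : Fin n) →
  ∑[ o < m ] (w o ∧ cross (A o) B u v) ≡ cross (λ z → ∑[ o < m ] (w o ∧ A o z)) B u v
∑-cross {zero}  w A B u v = sym (∧-zeroʳ (B u))
∑-cross {suc m} w A B u v =
  trans (cong (w zero ∧ cross (A zero) B u v xor_) (∑-cross (w ∘ suc) (A ∘ suc) B u v))
        (identity (w zero) (A zero u) (A zero v) _ _ (B u) (B v))
  where
  identity : ∀ w a a′ s s′ b b′ →
    (w ∧ ((a ∧ b′) xor (b ∧ a′))) xor ((s ∧ b′) xor (b ∧ s′)) ≡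
    (((w ∧ a) xor s) ∧ b′) xor (b ∧ ((w ∧ a′) xor s′))
  identity = solve-∀ BoolRing

∑-pair : (T : Pattern n) (u v : Fin n) → ∑[ x < n ] ∑[ y < n ] (T x y ∧ pair x y u v) ≡ T u v xor T v u
∑-pair {n} T u v = begin
  ∑[ x < n ] ∑[ y < n ] (T x y ∧ pair x y u v)
    ≡⟨ sum-cong-≗ (λ x → sum-cong-≗ (λ y → split (T x y) (u == x) (v == y) (u == y) (v == x))) ⟩
  ∑[ x < n ] ∑[ y < n ] (((u == x) ∧ ((v == y) ∧ T x y)) xor ((v == x) ∧ ((u == y) ∧ T x y)))
    ≡⟨ sum-cong-≗ select-inner ⟩
  ∑[ x < n ] (((u == x) ∧ T x v) xor ((v == x) ∧ T x u))
    ≡⟨ ∑-distrib-+ (λ x → (u == x) ∧ T x v) (λ x → (v == x) ∧ T x u) ⟩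
  ∑[ x < n ] ((u == x) ∧ T x v) xor ∑[ x < n ] ((v == x) ∧ T x u)
    ≡⟨ cong₂ _xor_ (∑-select u (λ x → T x v)) (∑-select v (λ x → T x u)) ⟩
  T u v xor T v u ∎
  where
  open ≡-Reasoning
  split : ∀ t ux vy uy vx → t ∧ ((ux ∧ vy) xor (uy ∧ vx)) ≡ (ux ∧ (vy ∧ t)) xor (vx ∧ (uy ∧ t))
  split = solve-∀ BoolRing
  select-inner : ∀ x → ∑[ y < n ] (((u == x) ∧ ((v == y) ∧ T x y)) xor ((v == x) ∧ ((u == y) ∧ T x y)))
                     ≡ ((u == x) ∧ T x v) xor ((v == x) ∧ T x u)
  select-inner x = begin
    ∑[ y < n ] (((u == x) ∧ ((v == y) ∧ T x y)) xor ((v == x) ∧ ((u == y) ∧ T x y)))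
      ≡⟨ ∑-distrib-+ (λ y → (u == x) ∧ ((v == y) ∧ T x y)) (λ y → (v == x) ∧ ((u == y) ∧ T x y)) ⟩
    ∑[ y < n ] ((u == x) ∧ ((v == y) ∧ T x y)) xor ∑[ y < n ] ((v == x) ∧ ((u == y) ∧ T x y))
      ≡⟨ cong₂ _xor_ (sym (*-distribˡ-sum (u == x) (λ y → (v == y) ∧ T x y)))
                     (sym (*-distribˡ-sum (v == x) (λ y → (u == y) ∧ T x y))) ⟩
    ((u == x) ∧ ∑[ y < n ] ((v == y) ∧ T x y)) xor ((v == x) ∧ ∑[ y < n ] ((u == y) ∧ T x y))
      ≡⟨ cong₂ (λ α β → ((u == x) ∧ α) xor ((v == x) ∧ β)) (∑-select v (T x)) (∑-select u (T x)) ⟩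
    ((u == x) ∧ T x v) xor ((v == x) ∧ T x u) ∎

flips : List (Subset n) → Pattern n
flips []       u v = false
flips (X ∷ Xs) u v = inside (lookup X) u v xor flips Xs u v

flips-++ : (Xs Ys : List (Subset n)) (u v : Fin n) → flips (Xs ++ Ys) u v ≡ flips Xs u v xor flips Ys u v
flips-++ []       Ys u v = refl
flips-++ (X ∷ Xs) Ys u v =
  trans (cong (inside (lookup X) u v xor_) (flips-++ Xs Ys u v)) (sym (xor-assoc (inside (lookup X) u v) _ _))

invertAll-flips : (Xs : List (Subset n)) (D : Digraph n) (u v : Fin n) →
  invertAll Xs D u v ≡ (if flips Xs u v then D v u else D u v)
invertAll-flips []       D u v = refl
invertAll-flips (X ∷ Xs) D u v
  rewrite invertAll-flips Xs (invert X D) u v | ∧-comm (lookup X v) (lookup X u)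
  = if-xor (inside (lookup X) u v) (flips Xs u v)
  where
  if-xor : ∀ c f → (if f then (if c then D u v else D v u) else (if c then D v u else D u v))
                 ≡ (if c xor f then D v u else D u v)
  if-xor false false = refl
  if-xor false true  = refl
  if-xor true  false = refl
  if-xor true  true  = refl

invert-oriented : (X : Subset n) {D : Digraph n} → IsOriented D → IsOriented (invert X D)
invert-oriented X {D} oriented = record { irrefl = irrefl′ ; asym = asym′ }
  where
  open IsOriented oriented
  irrefl′ : ∀ v → invert X D v v ≡ false
  irrefl′ v with lookup X v ∧ lookup X v
  ... | true  = irrefl v
  ... | false = irrefl v
  asym′ : ∀ u v → invert X D u v ≡ true → invert X D v u ≡ false
  asym′ u v rewrite ∧-comm (lookup X v) (lookup X u) with lookup X u ∧ lookup X v
  ... | true  = asym v u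
  ... | false = asym u v

invertAll-oriented : (Xs : List (Subset n)) {D : Digraph n} → IsOriented D → IsOriented (invertAll Xs D)
invertAll-oriented []       oriented = oriented
invertAll-oriented (X ∷ Xs) oriented = invertAll-oriented Xs (invert-oriented X oriented)

Reversal : ℕ → Pattern n → Set
Reversal {n} p R =
  Σ (List (Subset n)) λ Xs → All (λ X → ∣ X ∣ ≡ p) Xs × (∀ u v → u ≢ v → flips Xs u v ≡ R u v)

module _ {p : ℕ} where

  reversal-cong : {R S : Pattern n} → (∀ u v → u ≢ v → R u v ≡ S u v) → Reversal p R → Reversal p S
  reversal-cong R≗S (Xs , sizes , flips≗R) = Xs , sizes , λ u v u≢v → trans (flips≗R u v u≢v) (R≗S u v u≢v)

  reversal-∅ : Reversal {n} p (λ _ _ → false)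
  reversal-∅ = [] , [] , λ _ _ _ → refl

  reversal-inside : (A : Fin n → Bool) → size A ≡ p → Reversal p (inside A)
  reversal-inside A size≡p = tabulate A ∷ [] , size≡p ∷ [] , λ u v _ →
    trans (cong₂ (λ a b → (a ∧ b) xor false) (lookup∘tabulate A u) (lookup∘tabulate A v))
          (xor-identityʳ (inside A u v))

  reversal-xor : {R S : Pattern n} → Reversal p R → Reversal p S → Reversal p (λ u v → R u v xor S u v)
  reversal-xor (Xs , Xs-sizes , flips≗R) (Ys , Ys-sizes , flips≗S) =
    Xs ++ Ys , ++⁺ Xs-sizes Ys-sizes ,
    λ u v u≢v → trans (flips-++ Xs Ys u v) (cong₂ _xor_ (flips≗R u v u≢v) (flips≗S u v u≢v))

  reversal-∑ : {R : Fin m → Pattern n} → (∀ i → Reversal p (R i)) → Reversal p (λ u v → ∑[ i < m ] R i u v)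
  reversal-∑ {zero}  rev = reversal-∅
  reversal-∑ {suc m} rev = reversal-xor (rev zero) (reversal-∑ (rev ∘ suc))

  reversal-twins : (A : Fin n → Bool) (b c : Fin n) → size (⁅ b ⁆ ⊕ A) ≡ p → size (⁅ c ⁆ ⊕ A) ≡ p →
    Reversal p (cross A (⁅ b ⁆ ⊕ ⁅ c ⁆))
  reversal-twins A b c size-b size-c =
    reversal-cong twins (reversal-xor (reversal-inside _ size-b) (reversal-inside _ size-c))
    where
    twins : ∀ u v → u ≢ v →
      inside (⁅ b ⁆ ⊕ A) u v xor inside (⁅ c ⁆ ⊕ A) u v ≡ cross A (⁅ b ⁆ ⊕ ⁅ c ⁆) u v
    twins u v u≢v = trans (inside-twins A ⁅ b ⁆ ⁅ c ⁆ u v)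
      (cong₂ (λ β γ → (β xor γ) xor cross A (⁅ b ⁆ ⊕ ⁅ c ⁆) u v)
             (inside-⁅⁆ b u≢v) (inside-⁅⁆ c u≢v))

module Triangle (q : ℕ) {a b c : Fin n} (a≢b : a ≢ b) (a≢c : a ≢ c) (room : suc (suc (q * 2)) + 2 ≤ n) where

  p : ℕ
  p = suc (suc (q * 2))

  avoided : Fin n → Bool
  avoided z = ⁅ a ⁆ z ∨ (⁅ b ⁆ z ∨ ⁅ c ⁆ z)

  size-avoided : size avoided ≤ 3
  size-avoided = begin
    size avoided
      ≤⟨ size-∨ ⁅ a ⁆ _ ⟩
    size ⁅ a ⁆ + size (λ z → ⁅ b ⁆ z ∨ ⁅ c ⁆ z)
      ≤⟨ ℕ.+-monoʳ-≤ (size ⁅ a ⁆) (size-∨ ⁅ b ⁆ ⁅ c ⁆) ⟩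
    size ⁅ a ⁆ + (size ⁅ b ⁆ + size ⁅ c ⁆)
      ≡⟨ cong₂ _+_ (size-⁅⁆ a) (cong₂ _+_ (size-⁅⁆ b) (size-⁅⁆ c)) ⟩
    3 ∎
    where open ℕ.≤-Reasoning

  chosen : Σ (Fin n → Bool) λ Q → size Q ≡ suc (q * 2) × (∀ z → avoided z ≡ true → Q z ≡ false)
  chosen = subset-avoiding (suc (q * 2)) avoided
    (ℕ.≤-trans (ℕ.+-monoʳ-≤ (suc (q * 2)) size-avoided)
               (ℕ.≤-trans (ℕ.≤-reflexive (ℕ.+-suc (suc (q * 2)) 2)) room))

  Q : Fin n → Bool
  Q = proj₁ chosen

  Q-a : Q a ≡ false
  Q-a = proj₂ (proj₂ chosen) a a-avoided
    where
    a-avoided : avoided a ≡ true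
    a-avoided rewrite ==-refl a = refl

  Q-b : Q b ≡ false
  Q-b = proj₂ (proj₂ chosen) b b-avoided
    where
    b-avoided : avoided b ≡ true
    b-avoided rewrite ==-refl b = ∨-zeroʳ (b == a)

  Q-c : Q c ≡ false
  Q-c = proj₂ (proj₂ chosen) c c-avoided
    where
    c-avoided : avoided c ≡ true
    c-avoided rewrite ==-refl c | ∨-zeroʳ (c == b) = ∨-zeroʳ (c == a)

  -- For o ∈ Q this is {a} ∪ Q ∖ {o}.
  A : Fin n → Fin n → Bool
  A o = ⁅ a ⁆ ⊕ (⁅ o ⁆ ⊕ Q)

  size-side : {o x : Fin n} → Q o ≡ true → a ≢ x → Q x ≡ false → size (⁅ x ⁆ ⊕ A o) ≡ p
  size-side {o} {x} Qo≡true a≢x Qx≡false = begin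
    size (⁅ x ⁆ ⊕ A o)           ≡⟨ size-insert x (A o) x∉A ⟩
    suc (size (A o))              ≡⟨ cong suc (size-insert a (⁅ o ⁆ ⊕ Q) a∉Q∖o) ⟩
    suc (suc (size (⁅ o ⁆ ⊕ Q))) ≡⟨ cong suc (sym (size-insert o (⁅ o ⁆ ⊕ Q) o∉Q∖o)) ⟩
    suc (size (⁅ o ⁆ ⊕ (⁅ o ⁆ ⊕ Q))) ≡⟨ cong suc (size-cong remove-insert) ⟩
    suc (size Q)                  ≡⟨ cong suc (proj₁ (proj₂ chosen)) ⟩
    p                             ∎
    where
    open ≡-Reasoning
    x∉A : A o x ≡ false
    x∉A = cong₂ _xor_ (==-≢ (a≢x ∘ sym)) (cong₂ _xor_ (==-separated Q Qx≡false Qo≡true) Qx≡false)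
    a∉Q∖o : (⁅ o ⁆ ⊕ Q) a ≡ false
    a∉Q∖o = cong₂ _xor_ (==-separated Q Q-a Qo≡true) Q-a
    o∉Q∖o : (⁅ o ⁆ ⊕ Q) o ≡ false
    o∉Q∖o = cong₂ _xor_ (==-refl o) Qo≡true
    remove-insert : ∀ z → (⁅ o ⁆ ⊕ (⁅ o ⁆ ⊕ Q)) z ≡ Q z
    remove-insert z = trans (sym (xor-assoc (z == o) (z == o) (Q z))) (cong (_xor Q z) (xor-same (z == o)))

  reversal-at : (o : Fin n) → Reversal p (λ u v → Q o ∧ cross (A o) (⁅ b ⁆ ⊕ ⁅ c ⁆) u v)
  reversal-at o with Q o in Qo≡true
  ... | true  = reversal-twins (A o) b c (size-side Qo≡true a≢b Q-b) (size-side Qo≡true a≢c Q-c)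
  ... | false = reversal-∅

  -- a lies in all |Q| of the sets A o with o ∈ Q, a vertex of Q in |Q| − 1 of them, any other vertex
  -- in none; as |Q| is odd, only a is counted an odd number of times.
  ∑-A : (z : Fin n) → ∑[ o < n ] (Q o ∧ A o z) ≡ ⁅ a ⁆ z
  ∑-A z = begin
    ∑[ o < n ] (Q o ∧ A o z)
      ≡⟨ sum-cong-≗ (λ o → expand (Q o) (⁅ a ⁆ z) (z == o) (Q z)) ⟩
    ∑[ o < n ] ((Q o ∧ ⁅ a ⁆ z) xor ((Q o ∧ Q z) xor ((z == o) ∧ Q o)))
      ≡⟨ trans (∑-distrib-+ (λ o → Q o ∧ ⁅ a ⁆ z) _)
               (cong (∑[ o < n ] (Q o ∧ ⁅ a ⁆ z) xor_)
                     (∑-distrib-+ (λ o → Q o ∧ Q z) (λ o → (z == o) ∧ Q o))) ⟩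
    ∑[ o < n ] (Q o ∧ ⁅ a ⁆ z) xor (∑[ o < n ] (Q o ∧ Q z) xor ∑[ o < n ] ((z == o) ∧ Q o))
      ≡⟨ cong₂ (λ α β → α xor (β xor ∑[ o < n ] ((z == o) ∧ Q o)))
               (sym (*-distribʳ-sum (⁅ a ⁆ z) Q)) (sym (*-distribʳ-sum (Q z) Q)) ⟩
    (∑[ o < n ] Q o ∧ ⁅ a ⁆ z) xor ((∑[ o < n ] Q o ∧ Q z) xor ∑[ o < n ] ((z == o) ∧ Q o))
      ≡⟨ cong₂ (λ α β → (α ∧ ⁅ a ⁆ z) xor ((α ∧ Q z) xor β))
               (∑-odd Q q (proj₁ (proj₂ chosen))) (∑-select z Q) ⟩
    ⁅ a ⁆ z xor (Q z xor Q z)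
      ≡⟨ trans (cong (⁅ a ⁆ z xor_) (xor-same (Q z))) (xor-identityʳ (⁅ a ⁆ z)) ⟩
    ⁅ a ⁆ z ∎
    where
    open ≡-Reasoning
    expand : ∀ w α ζ β → w ∧ (α xor (ζ xor β)) ≡ (w ∧ α) xor ((w ∧ β) xor (ζ ∧ w))
    expand = solve-∀ BoolRing

  reversal : Reversal p (λ u v → pair a b u v xor pair a c u v)
  reversal = reversal-cong collapse (reversal-∑ reversal-at)
    where
    collapse : ∀ u v → u ≢ v →
      ∑[ o < n ] (Q o ∧ cross (A o) (⁅ b ⁆ ⊕ ⁅ c ⁆) u v) ≡ pair a b u v xor pair a c u v
    collapse u v _ = begin
      ∑[ o < n ] (Q o ∧ cross (A o) (⁅ b ⁆ ⊕ ⁅ c ⁆) u v)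
        ≡⟨ ∑-cross Q A (⁅ b ⁆ ⊕ ⁅ c ⁆) u v ⟩
      cross (λ z → ∑[ o < n ] (Q o ∧ A o z)) (⁅ b ⁆ ⊕ ⁅ c ⁆) u v
        ≡⟨ cong₂ (λ α α′ → (α ∧ _) xor (_ ∧ α′)) (∑-A u) (∑-A v) ⟩
      cross ⁅ a ⁆ (⁅ b ⁆ ⊕ ⁅ c ⁆) u v
        ≡⟨ cross-⊕ʳ ⁅ a ⁆ ⁅ b ⁆ ⁅ c ⁆ u v ⟩
      pair a b u v xor pair a c u v ∎
      where open ≡-Reasoning

reversal-triangle : (q : ℕ) {a b c : Fin n} → a ≢ b → a ≢ c → suc (suc (q * 2)) + 2 ≤ n →
  Reversal (suc (suc (q * 2))) (λ u v → pair a b u v xor pair a c u v)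
reversal-triangle q a≢b a≢c room = Triangle.reversal q a≢b a≢c room

pair₀₁ : Pattern (suc (suc m))
pair₀₁ = pair zero (suc zero)

pair₀₁-flip : (u v : Fin (suc (suc m))) → pair₀₁ v u ≡ pair₀₁ u v
pair₀₁-flip u v = identity (u == zero) (v == zero) (u == suc zero) (v == suc zero)
  where
  identity : ∀ a a′ b b′ → (a′ ∧ b) xor (b′ ∧ a) ≡ (a ∧ b′) xor (b ∧ a′)
  identity = solve-∀ BoolRing

lower : Pattern (suc (suc m)) → Pattern (suc (suc m))
lower R x y = does (y <? x) ∧ (not (pair₀₁ x y) ∧ R x y)

lower-xor-flip : (R : Pattern (suc (suc m))) → (∀ u v → R u v ≡ R v u) →
  {u v : Fin (suc (suc m))} → u ≢ v → pair₀₁ u v ≡ false → lower R u v xor lower R v u ≡ R u v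
lower-xor-flip R R-sym {u} {v} u≢v not01 = begin
  lower R u v xor lower R v u
    ≡⟨ cong₂ (λ α β → (does (v <? u) ∧ (not α ∧ R u v)) xor (does (u <? v) ∧ (not β ∧ R v u)))
             not01 (trans (pair₀₁-flip u v) not01) ⟩
  (does (v <? u) ∧ R u v) xor (does (u <? v) ∧ R v u)
    ≡⟨ by-order (v <? u) (u <? v) ⟩
  R u v ∎
  where
  open ≡-Reasoning
  by-order : (v<u? : Dec (v Fin.< u)) (u<v? : Dec (u Fin.< v)) →
    (does v<u? ∧ R u v) xor (does u<v? ∧ R v u) ≡ R u v
  by-order (yes v<u) (yes u<v) = contradiction v<u (<-asym u<v)
  by-order (yes _)   (no _)    = xor-identityʳ (R u v)
  by-order (no _)    (yes _)   = R-sym v u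
  by-order (no v≮u)  (no u≮v)  = contradiction (≤∧≢⇒< (ℕ.≮⇒≥ u≮v) (≢-sym u≢v)) v≮u

module _ (q : ℕ) {m : ℕ} (room : suc (suc (q * 2)) + 2 ≤ suc (suc m)) where

  private
    p : ℕ
    p = suc (suc (q * 2))

  reversal-pair⊕pair₀₁ : (x y : Fin (suc (suc m))) → y Fin.< x → pair₀₁ x y ≡ false →
    Reversal p (λ u v → pair x y u v xor pair₀₁ u v)
  reversal-pair⊕pair₀₁ zero          y             () _
  reversal-pair⊕pair₀₁ (suc zero)    zero          _ ()
  reversal-pair⊕pair₀₁ (suc zero)    (suc y)       (s≤s ()) _
  reversal-pair⊕pair₀₁ (suc (suc k)) zero          _ _ =
    reversal-cong (λ u v _ → cong (_xor pair₀₁ u v) (pair-comm zero (suc (suc k)) u v))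
      (reversal-triangle q (λ ()) (λ ()) room)
  reversal-pair⊕pair₀₁ (suc (suc k)) (suc zero)    _ _ =
    reversal-cong (λ u v _ → cong₂ _xor_ (pair-comm (suc zero) (suc (suc k)) u v) (pair-comm (suc zero) zero u v))
      (reversal-triangle q (λ ()) (λ ()) room)
  reversal-pair⊕pair₀₁ x@(suc (suc _)) y@(suc (suc _)) y<x _ =
    reversal-cong (λ u v _ → detour (pair x y u v) (pair x zero u v) (pair zero x u v) (pair₀₁ u v)
                                    (pair-comm x zero u v))
      (reversal-xor (reversal-triangle q (≢-sym (<⇒≢ y<x)) (λ ()) room) (reversal-triangle q (λ ()) (λ ()) room))
    where
    detour : ∀ α β β′ γ → β ≡ β′ → (α xor β) xor (β′ xor γ) ≡ α xor γ
    detour α β .β γ refl = identity α β γ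
      where
      identity : ∀ α β γ → (α xor β) xor (β xor γ) ≡ α xor γ
      identity = solve-∀ BoolRing

  reversal-lower-term : (R : Pattern (suc (suc m))) (x y : Fin (suc (suc m))) →
    Reversal p (λ u v → lower R x y ∧ (pair x y u v xor pair₀₁ u v))
  reversal-lower-term R x y = reversal-when (y <? x)
    where
    reversal-when : (y<x? : Dec (y Fin.< x)) →
      Reversal p (λ u v → (does y<x? ∧ (not (pair₀₁ x y) ∧ R x y)) ∧ (pair x y u v xor pair₀₁ u v))
    reversal-when (no _) = reversal-∅
    reversal-when (yes y<x) with pair₀₁ x y in not01 | R x y
    ... | false | true  = reversal-pair⊕pair₀₁ x y y<x not01
    ... | false | false = reversal-∅
    ... | true  | _     = reversal-∅

  reversal-off₀₁ : (R : Pattern (suc (suc m))) → (∀ u v → R u v ≡ R v u) →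
    Σ (List (Subset (suc (suc m)))) λ Xs → All (λ X → ∣ X ∣ ≡ p) Xs ×
      (∀ u v → u ≢ v → pair₀₁ u v ≡ false → flips Xs u v ≡ R u v)
  reversal-off₀₁ R R-sym with reversal-∑ (λ x → reversal-∑ (reversal-lower-term R x))
  ... | Xs , sizes , flips≗ = Xs , sizes , λ u v u≢v not01 → begin
    flips Xs u v
      ≡⟨ flips≗ u v u≢v ⟩
    ∑[ x < suc (suc m) ] ∑[ y < suc (suc m) ] (lower R x y ∧ (pair x y u v xor pair₀₁ u v))
      ≡⟨ sum-cong-≗ (λ x → sum-cong-≗ λ y →
           cong (lower R x y ∧_) (trans (cong (pair x y u v xor_) not01) (xor-identityʳ (pair x y u v)))) ⟩
    ∑[ x < suc (suc m) ] ∑[ y < suc (suc m) ] (lower R x y ∧ pair x y u v)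
      ≡⟨ ∑-pair (lower R) u v ⟩
    lower R u v xor lower R v u
      ≡⟨ lower-xor-flip R R-sym u≢v not01 ⟩
    R u v ∎
    where open ≡-Reasoning

ranked⇒acyclic : (G : Digraph n) (r : Fin n → ℕ) → (∀ u v → G u v ≡ true → r u < r v) → Acyclic G
ranked⇒acyclic G r increasing cycle = ℕ.<⇒≱ (increasing _ _ close) (rises k (fromℕ k) (toℕ-fromℕ k))
  where
  open DirectedCycle cycle
  rises : ∀ j (i : Fin (suc k)) → toℕ i ≡ j → r (w zero) ≤ r (w i)
  rises zero    zero    _   = ℕ.≤-refl
  rises zero    (suc i) ()
  rises (suc j) zero    ()
  rises (suc j) (suc i) i≡j = ℕ.≤-trans (rises j (inject₁ i) (trans (toℕ-inject₁ i) (ℕ.suc-injective i≡j)))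
                                        (ℕ.<⇒≤ (increasing _ _ (step i)))

ordered-off₀₁⇒acyclic : {G : Digraph (suc (suc m))} → IsOriented G →
  (∀ u v → pair₀₁ u v ≡ false → G u v ≡ true → u Fin.< v) → Acyclic G
ordered-off₀₁⇒acyclic {m} {G} oriented ordered = ranked⇒acyclic G rank increasing
  where
  open IsOriented oriented
  rank : Fin (suc (suc m)) → ℕ
  rank zero          = if G (suc zero) zero then 2 else 0
  rank (suc zero)    = 1
  rank (suc (suc k)) = 3 + toℕ k
  increasing : ∀ u v → G u v ≡ true → rank u < rank v
  increasing zero          zero          arc with ordered _ _ refl arc
  ... | ()
  increasing zero          (suc zero)    arc rewrite asym zero (suc zero) arc = s≤s z≤n
  increasing zero          (suc (suc l)) _   with G (suc zero) zero
  ... | true  = s≤s (s≤s (s≤s z≤n))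
  ... | false = s≤s z≤n
  increasing (suc zero)    zero          arc rewrite arc = s≤s (s≤s z≤n)
  increasing (suc zero)    (suc zero)    arc with ordered _ _ refl arc
  ... | s≤s ()
  increasing (suc zero)    (suc (suc l)) _   = s≤s (s≤s z≤n)
  increasing (suc (suc k)) zero          arc with ordered _ _ refl arc
  ... | ()
  increasing (suc (suc k)) (suc zero)    arc with ordered _ _ refl arc
  ... | s≤s ()
  increasing (suc (suc k)) (suc (suc l)) arc with ordered _ _ refl arc
  ... | s≤s (s≤s k<l) = s≤s (s≤s (s≤s k<l))

reversed-arc : (D : Digraph n) → IsOriented D → (u v : Fin n) → (if D u v then D v u else D u v) ≡ false
reversed-arc D oriented u v with D u v in uv
... | true  = IsOriented.asym oriented u v uv
... | false = refl

backward : Digraph n → Pattern n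
backward D u v = (does (v <? u) ∧ D u v) xor (does (u <? v) ∧ D v u)

backward-sym : (D : Digraph n) (u v : Fin n) → backward D u v ≡ backward D v u
backward-sym D u v = xor-comm (does (v <? u) ∧ D u v) (does (u <? v) ∧ D v u)

reversing-backward⇒ordered-off₀₁ : (D : Digraph (suc (suc m))) → IsOriented D →
  (Xs : List (Subset (suc (suc m)))) →
  (∀ u v → u ≢ v → pair₀₁ u v ≡ false → flips Xs u v ≡ backward D u v) →
  ∀ u v → pair₀₁ u v ≡ false → invertAll Xs D u v ≡ true → u Fin.< v
reversing-backward⇒ordered-off₀₁ D oriented Xs flips≗ u v not01 arc with u ≟ v
... | yes refl = contradiction (trans (sym arc) (IsOriented.irrefl (invertAll-oriented Xs oriented) u)) λ ()
... | no u≢v   = by-order (v <? u) (u <? v) refl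
  where
  by-order : (v<u? : Dec (v Fin.< u)) (u<v? : Dec (u Fin.< v)) →
    backward D u v ≡ (does v<u? ∧ D u v) xor (does u<v? ∧ D v u) → u Fin.< v
  by-order _         (yes u<v) _         = u<v
  by-order (no v≮u)  (no u≮v)  _         = contradiction (≤∧≢⇒< (ℕ.≮⇒≥ u≮v) (≢-sym u≢v)) v≮u
  by-order (yes v<u) (no _)    backward≡ = contradiction (begin
    true                                    ≡⟨ arc ⟨
    invertAll Xs D u v                      ≡⟨ invertAll-flips Xs D u v ⟩
    (if flips Xs u v then D v u else D u v) ≡⟨ cong (λ b → if b then D v u else D u v) flips≡ ⟩
    (if D u v then D v u else D u v)        ≡⟨ reversed-arc D oriented u v ⟩
    false                                   ∎) λ ()
    where
    open ≡-Reasoning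
    flips≡ : flips Xs u v ≡ D u v
    flips≡ = trans (flips≗ u v u≢v not01) (trans backward≡ (xor-identityʳ (D u v)))

oriented⇒eqInvertible : (q : ℕ) {m : ℕ} → suc (suc (q * 2)) + 2 ≤ suc (suc m) →
  (D : Digraph (suc (suc m))) → IsOriented D → EqInvertible (suc (suc (q * 2))) D
oriented⇒eqInvertible q room D oriented =
  let Xs , sizes , flips≗ = reversal-off₀₁ q room (backward D) (backward-sym D)
  in  Xs , sizes , ordered-off₀₁⇒acyclic (invertAll-oriented Xs oriented)
                                         (reversing-backward⇒ordered-off₀₁ D oriented Xs flips≗)

theorem1p5 : (p : ℕ) → 0 < p → 2 ∣ p → (n : ℕ) → p + 2 ≤ n →
    (D : Digraph n) → IsOriented D → EqInvertible p D
theorem1p5 _ ()  (divides zero refl)    _             _        _ _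
theorem1p5 _ _   (divides (suc q) refl) 1             (s≤s ()) _ _
theorem1p5 _ _   (divides (suc q) refl) (suc (suc m)) room     D oriented = oriented⇒eqInvertible q room D oriented
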